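{- Let $1 \le s \le t$ be integers, and let $G_1$ and $G_2$ be graphs not containing $K_{s,t}$ as a minor. Let $C:=V(G_1) \cap V(G_2)$. If $C$ forms a clique in both $G_1$ and $G_2$, and if $|C|<s$, then the graph $G_1 \cup G_2$ (with vertex set $V(G_1)\cup V(G_2)$ and edge set $E(G_1)\cup E(G_2)$) also does not contain $K_{s,t}$ as a minor.
   Context: All graphs are finite, loopless and without parallel edges. $K_{s,t}$ denotes the complete bipartite graph with bipartition classes of sizes $s$ and $t$. A graph $G$ contains $F$ as a minor if there are pairwise disjoint non-empty sets $(Z_f)_{f\in V(F)}$ of vertices of $G$ such that each induced subgraph $G[Z_f]$ is connected and for every edge $f_1f_2$ of $F$ there is an edge of $G$ between $Z_{f_1}$ and $Z_{f_2}$. -}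

module Defs where

open import Data.Nat using (ℕ; _<_)
open import Data.Fin using (Fin)
open import Data.Sum using (_⊎_; inj₁; inj₂)
open import Data.Product using (_×_; Σ; ∃)
open import Data.Unit using (⊤)
open import Data.Empty using (⊥)
open import Data.List using (List; length; _++_)
open import Data.List.Membership.Propositional using (_∈_)
open import Data.List.Relation.Unary.Unique.Propositional using (Unique)
open import Relation.Nullary using (¬_)
open import Relation.Binary.PropositionalEquality using (_≡_; _≢_)

-- A finite simple graph whose vertices are natural numbers (any finite
-- vertex set can be labelled by naturals).
record Graph : Set₁ where
  field
    V       : List ℕ
    E       : ℕ → ℕ → Set
    E-sym   : ∀ {x y} → E x y → E y x
    E-irr   : ∀ {x} → ¬ E x x
    E-left  : ∀ {x y} → E x y → x ∈ V
open Graph public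

_∪G_ : Graph → Graph → Graph
G₁ ∪G G₂ = record
  { V      = V G₁ ++ V G₂
  ; E      = λ x y → E G₁ x y ⊎ E G₂ x y
  ; E-sym  = sym'
  ; E-irr  = irr'
  ; E-left = left'
  }
  where
  open import Data.List.Membership.Propositional.Properties using (∈-++⁺ˡ; ∈-++⁺ʳ)
  sym' : ∀ {x y} → E G₁ x y ⊎ E G₂ x y → E G₁ y x ⊎ E G₂ y x
  sym' (inj₁ e) = inj₁ (E-sym G₁ e)
  sym' (inj₂ e) = inj₂ (E-sym G₂ e)
  irr' : ∀ {x} → ¬ (E G₁ x x ⊎ E G₂ x x)
  irr' (inj₁ e) = E-irr G₁ e
  irr' (inj₂ e) = E-irr G₂ e
  left' : ∀ {x y} → E G₁ x y ⊎ E G₂ x y → x ∈ (V G₁ ++ V G₂)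
  left' (inj₁ e) = ∈-++⁺ˡ (E-left G₁ e)
  left' (inj₂ e) = ∈-++⁺ʳ (V G₁) (E-left G₂ e)

Common : Graph → Graph → ℕ → Set
Common G₁ G₂ x = (x ∈ V G₁) × (x ∈ V G₂)

IsClique : Graph → (ℕ → Set) → Set
IsClique G S = ∀ {x y} → S x → S y → x ≢ y → E G x y

CardLt : (ℕ → Set) → ℕ → Set
CardLt S k = Σ (List ℕ) λ L → Unique L × (∀ x → (S x → x ∈ L) × (x ∈ L → S x)) × length L < k

data WalkIn (G : Graph) (Z : ℕ → Set) : ℕ → ℕ → Set where
  here : ∀ {x} → Z x → WalkIn G Z x x
  step : ∀ {x y z} → Z x → E G x y → WalkIn G Z y z → WalkIn G Z x z

-- G[Z] connected (Z will additionally be required non-empty).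
ConnectedIn : Graph → (ℕ → Set) → Set
ConnectedIn G Z = ∀ {x y} → Z x → Z y → WalkIn G Z x y

HasMinor : Graph → (W : Set) → (W → W → Set) → Set₁
HasMinor G W R =
  Σ (W → ℕ → Set) λ Z →
    (∀ f → ∃ λ x → Z f x) ×
    (∀ f {x} → Z f x → x ∈ V G) ×
    (∀ f g {x} → f ≢ g → Z f x → Z g x → ⊥) ×
    (∀ f → ConnectedIn G (Z f)) ×
    (∀ f g → R f g → Σ ℕ λ x → Σ ℕ λ y → Z f x × Z g y × E G x y)

KAdj : (s t : ℕ) → Fin s ⊎ Fin t → Fin s ⊎ Fin t → Set
KAdj s t (inj₁ _) (inj₁ _) = ⊥
KAdj s t (inj₁ _) (inj₂ _) = ⊤
KAdj s t (inj₂ _) (inj₁ _) = ⊤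
KAdj s t (inj₂ _) (inj₂ _) = ⊥

HasKstMinor : Graph → ℕ → ℕ → Set₁
HasKstMinor G s t = HasMinor G (Fin s ⊎ Fin t) (KAdj s t)

{-# OPTIONS --safe #-}
-- As |C| < s ≤ t and
-- the branch sets are disjoint, some branch set A on the s-side and some B on
-- the t-side miss C.  A connected set missing C cannot cross between
-- V(G₁) ∖ C and V(G₂) ∖ C, so A lies inside one side, say V(G₁); then every
-- neighbour of A, in particular B, meets V(G₁), and hence so does every branch
-- set.  Intersecting all branch sets with V(G₁) now gives a K_{s,t} minor of
-- G₁: a stretch of a walk (or an edge) outside G₁ enters and leaves V(G₁)
-- through C, and C is a clique of G₁, so it can be short-cut inside G₁.
module Submission where

open import Defs
open import Data.Nat using (ℕ; _≤_; _<_; _≟_)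
open import Data.Nat.Properties using (<-≤-trans)
open import Data.Fin using (Fin; zero; suc)
open import Data.Fin.Properties using (pigeonhole; <⇒≢)
open import Data.Sum using (_⊎_; inj₁; inj₂; [_,_]′) renaming (swap to ⊎-swap)
open import Data.Sum.Properties using (inj₁-injective; inj₂-injective)
open import Data.Product using (_×_; Σ; ∃; _,_; proj₁; proj₂; swap)
open import Data.Unit using (tt)
open import Data.Empty using (⊥; ⊥-elim)
open import Data.List using (List; length; lookup)
open import Data.List.Membership.Propositional using (_∈_; _∉_)
open import Data.List.Membership.Propositional.Properties using (∈-++⁻)
open import Data.List.Membership.DecPropositional _≟_ using (_∈?_)
open import Data.List.Relation.Unary.Any using (index)
open import Data.List.Relation.Unary.Any.Properties using (lookup-index; ++-comm)
open import Function using (_∘_)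
open import Relation.Nullary using (¬_; yes; no)
open import Relation.Binary.PropositionalEquality using (_≡_; _≢_; refl; sym; cong; subst; module ≡-Reasoning)

E-right : ∀ G {x y} → E G x y → y ∈ V G
E-right G e = E-left G (E-sym G e)

WalkIn-head : ∀ {G Z x y} → WalkIn G Z x y → Z x
WalkIn-head (here z)     = z
WalkIn-head (step z _ _) = z

WalkIn-map : ∀ {G H Z x y} → (∀ {u v} → E G u v → E H u v) → WalkIn G Z x y → WalkIn H Z x y
WalkIn-map f (here z)     = here z
WalkIn-map f (step z e w) = step z (f e) (WalkIn-map f w)

HasMinor-∪G-comm : ∀ {G₁ G₂ W R} → HasMinor (G₁ ∪G G₂) W R → HasMinor (G₂ ∪G G₁) W R
HasMinor-∪G-comm {G₁} {G₂} (Z , nonempty , ⊆V , disjoint , connected , adjacent) =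
  Z , nonempty , (λ f z → ++-comm (V G₁) (V G₂) (⊆V f z)) , disjoint ,
  (λ f zx zy → WalkIn-map ⊎-swap (connected f zx zy)) , adjacent′
  where
  adjacent′ : ∀ f g → _ → Σ ℕ λ x → Σ ℕ λ y → Z f x × Z g y × E (G₂ ∪G G₁) x y
  adjacent′ f g r = let (x , y , zx , zy , e) = adjacent f g r in x , y , zx , zy , ⊎-swap e

KAdj⇒≢ : ∀ {s t} {f g : Fin s ⊎ Fin t} → KAdj s t f g → f ≢ g
KAdj⇒≢ {f = inj₁ _} {inj₁ _} ()
KAdj⇒≢ {f = inj₁ _} {inj₂ _} _ ()
KAdj⇒≢ {f = inj₂ _} {inj₁ _} _ ()
KAdj⇒≢ {f = inj₂ _} {inj₂ _} ()

¬¬-Π-Fin : ∀ {n} {P : Fin n → Set} → (∀ i → ¬ ¬ P i) → ¬ ¬ (∀ i → P i)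
¬¬-Π-Fin {ℕ.zero}  h ¬∀ = ¬∀ (λ ())
¬¬-Π-Fin {ℕ.suc n} h ¬∀ =
  h zero λ p₀ → ¬¬-Π-Fin (λ i → h (suc i)) λ ps → ¬∀ λ { zero → p₀ ; (suc i) → ps i }

module _ {n} (Z : Fin n → ℕ → Set) (disjoint : ∀ {i j x} → i ≢ j → Z i x → Z j x → ⊥)
         (L : List ℕ) (short : length L < n) where

  disjoint-sets-cannot-all-meet : ¬ (∀ i → ∃ λ x → Z i x × x ∈ L)
  disjoint-sets-cannot-all-meet meet
    with i , j , i<j , same-index ← pigeonhole short (λ i → index (proj₂ (proj₂ (meet i))))
    = disjoint (<⇒≢ i<j) (in-set i) (subst (Z j) (sym same-point) (in-set j))
    where
    open ≡-Reasoning
    point : Fin n → ℕ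
    point i = proj₁ (meet i)
    in-set : ∀ i → Z i (point i)
    in-set i = proj₁ (proj₂ (meet i))
    position : ∀ i → point i ∈ L
    position i = proj₂ (proj₂ (meet i))
    same-point : point i ≡ point j
    same-point = begin
      point i                       ≡⟨ lookup-index (position i) ⟩
      lookup L (index (position i)) ≡⟨ cong (lookup L) same-index ⟩
      lookup L (index (position j)) ≡⟨ sym (lookup-index (position j)) ⟩
      point j                       ∎

  -- Only ¬¬: membership in the branch sets is not decidable.
  ¬¬-some-set-avoids : ¬ ¬ (∃ λ i → ∀ {x} → Z i x → x ∉ L)
  ¬¬-some-set-avoids ¬avoids =
    ¬¬-Π-Fin (λ i ¬meets → ¬avoids (i , λ zx x∈L → ¬meets (_ , zx , x∈L)))
             disjoint-sets-cannot-all-meet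

module Union (G₁ G₂ : Graph) where

  G : Graph
  G = G₁ ∪G G₂

  C : ℕ → Set
  C = Common G₁ G₂

  Avoids : (ℕ → Set) → Set
  Avoids Z = ∀ {x} → Z x → ¬ C x

  _∩V₁ : (ℕ → Set) → ℕ → Set
  (Z ∩V₁) x = Z x × x ∈ V G₁

  Meets₁ : (ℕ → Set) → Set
  Meets₁ Z = ∃ (Z ∩V₁)

  E-leaving-V₁ : ∀ {u v} → E G u v → v ∉ V G₁ → E G₂ u v
  E-leaving-V₁ (inj₁ e) v∉ = ⊥-elim (v∉ (E-right G₁ e))
  E-leaving-V₁ (inj₂ e) v∉ = e

  E-entering-V₁ : ∀ {u v} → E G u v → u ∉ V G₁ → E G₂ u v
  E-entering-V₁ (inj₁ e) u∉ = ⊥-elim (u∉ (E-left G₁ e))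
  E-entering-V₁ (inj₂ e) u∉ = e

  avoiding-walk-stays-in-V₁ : ∀ {Z u w} → Avoids Z → WalkIn G Z u w → u ∈ V G₁ → w ∈ V G₁
  avoiding-walk-stays-in-V₁ avoids (here _)            u∈ = u∈
  avoiding-walk-stays-in-V₁ avoids (step zu (inj₁ e) w) u∈ = avoiding-walk-stays-in-V₁ avoids w (E-right G₁ e)
  avoiding-walk-stays-in-V₁ avoids (step zu (inj₂ e) w) u∈ = ⊥-elim (avoids zu (u∈ , E-left G₂ e))

  walk-enters-V₁-through-C : ∀ {Z u y} → WalkIn G Z u y → u ∉ V G₁ → y ∈ V G₁ → ∃ λ c → C c × Z c
  walk-enters-V₁-through-C (here _) u∉ y∈ = ⊥-elim (u∉ y∈)
  walk-enters-V₁-through-C (step {y = v} _ e w) u∉ y∈ with v ∈? V G₁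
  ... | no v∉ = walk-enters-V₁-through-C w v∉ y∈
  ... | yes v∈ = v , (v∈ , E-right G₂ (E-entering-V₁ e u∉)) , WalkIn-head w

  connected-meets-C : ∀ {Z x} → ConnectedIn G Z → Meets₁ Z → Z x → x ∈ V G₂ → ∃ λ c → C c × Z c
  connected-meets-C {x = x} connected (y , zy , y∈) zx x∈₂ with x ∈? V G₁
  ... | yes x∈₁ = x , (x∈₁ , x∈₂) , zx
  ... | no x∉₁ = walk-enters-V₁-through-C (connected zx zy) x∉₁ y∈

  avoiding-neighbour-meets-V₁ : ∀ {Z Z′} → ConnectedIn G Z → Avoids Z →
    (Σ ℕ λ x → Σ ℕ λ y → Z x × Z′ y × E G x y) → Meets₁ Z → Meets₁ Z′
  avoiding-neighbour-meets-V₁ connected avoids (x , y , zx , zy , e) (u , zu , u∈)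
    with avoiding-walk-stays-in-V₁ avoids (connected zu zx) u∈ | e
  ... | x∈ | inj₁ e₁ = y , zy , E-right G₁ e₁
  ... | x∈ | inj₂ e₂ = ⊥-elim (avoids zx (x∈ , E-left G₂ e₂))

  module _ (clique : IsClique G₁ C) where

    E-within-V₁ : ∀ {u v} → E G u v → u ∈ V G₁ → v ∈ V G₁ → E G₁ u v
    E-within-V₁ (inj₁ e) u∈ v∈ = e
    E-within-V₁ (inj₂ e) u∈ v∈ =
      clique (u∈ , E-left G₂ e) (v∈ , E-right G₂ e) (λ { refl → E-irr G₂ e })

    walk-from-C : ∀ {Z x c y} → C x → C c → (Z ∩V₁) x → WalkIn G₁ (Z ∩V₁) c y → WalkIn G₁ (Z ∩V₁) x y
    walk-from-C {x = x} {c} Cx Cc zx w with x ≟ c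
    ... | yes refl = w
    ... | no x≢c = step zx (clique Cx Cc x≢c) w

    -- A walk from u is rebuilt inside G₁ from x, where x is u itself or, while
    -- the walk is still outside V(G₁), the vertex of C through which it left.
    restrict-walk : ∀ {Z u y} → WalkIn G Z u y → y ∈ V G₁ →
      ∀ {x} → (Z ∩V₁) x → x ≡ u ⊎ (C x × u ∉ V G₁) → WalkIn G₁ (Z ∩V₁) x y
    restrict-walk (here _) y∈ zx (inj₁ refl)      = here zx
    restrict-walk (here _) y∈ zx (inj₂ (_ , y∉)) = ⊥-elim (y∉ y∈)
    restrict-walk (step {y = v} zu e w) y∈ zx x≈u with v ∈? V G₁ | x≈u
    ... | no v∉ | inj₁ refl        =
      restrict-walk w y∈ zx (inj₂ ((proj₂ zx , E-left G₂ (E-leaving-V₁ e v∉)) , v∉))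
    ... | no v∉ | inj₂ (Cx , _)    = restrict-walk w y∈ zx (inj₂ (Cx , v∉))
    ... | yes v∈ | inj₁ refl       =
      step zx (E-within-V₁ e (proj₂ zx) v∈) (restrict-walk w y∈ (WalkIn-head w , v∈) (inj₁ refl))
    ... | yes v∈ | inj₂ (Cx , u∉)  =
      walk-from-C Cx (v∈ , E-right G₂ (E-entering-V₁ e u∉)) zx
        (restrict-walk w y∈ (WalkIn-head w , v∈) (inj₁ refl))

    restrict-connected : ∀ {Z} → ConnectedIn G Z → ConnectedIn G₁ (Z ∩V₁)
    restrict-connected connected zx (zy , y∈) = restrict-walk (connected (proj₁ zx) zy) y∈ zx (inj₁ refl)

    restrict-minor : ∀ {W R} → (∀ {f g} → R f g → f ≢ g) → (M : HasMinor G W R) →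
      (∀ f → Meets₁ (proj₁ M f)) → HasMinor G₁ W R
    restrict-minor {W} {R} R⇒≢ (Z , _ , _ , disjoint , connected , adjacent) meets =
      (λ f → Z f ∩V₁) , meets , (λ f → proj₂) ,
      (λ f g f≢g zf zg → disjoint f g f≢g (proj₁ zf) (proj₁ zg)) ,
      (λ f → restrict-connected (connected f)) , adjacent₁
      where
      adjacent₁ : ∀ f g → R f g → Σ ℕ λ x → Σ ℕ λ y → (Z f ∩V₁) x × (Z g ∩V₁) y × E G₁ x y
      adjacent₁ f g r with adjacent f g r
      ... | x , y , zx , zy , inj₁ e = x , y , (zx , E-left G₁ e) , (zy , E-right G₁ e) , e
      ... | x , y , zx , zy , inj₂ e
        with c , Cc , zc ← connected-meets-C (connected f) (meets f) zx (E-left G₂ e)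
           | d , Cd , zd ← connected-meets-C (connected g) (meets g) zy (E-right G₂ e)
        = c , d , (zc , proj₁ Cc) , (zd , proj₁ Cd) ,
          clique Cc Cd (λ { refl → disjoint f g (R⇒≢ r) zc zd })

    Kst-minor-in-G₁ : ∀ {s t} (M : HasKstMinor G s t) a b →
      Avoids (proj₁ M (inj₁ a)) → Avoids (proj₁ M (inj₂ b)) → Meets₁ (proj₁ M (inj₁ a)) →
      HasKstMinor G₁ s t
    Kst-minor-in-G₁ M@(Z , _ , _ , _ , connected , adjacent) a b avoids-a avoids-b meets-a =
      restrict-minor KAdj⇒≢ M meets
      where
      via : ∀ f g → Avoids (Z f) → KAdj _ _ f g → Meets₁ (Z f) → Meets₁ (Z g)
      via f g avoids r = avoiding-neighbour-meets-V₁ (connected f) avoids (adjacent f g r)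
      meets : ∀ h → Meets₁ (Z h)
      meets (inj₂ j) = via (inj₁ a) (inj₂ j) avoids-a tt meets-a
      meets (inj₁ i) = via (inj₂ b) (inj₁ i) avoids-b tt (via (inj₁ a) (inj₂ b) avoids-a tt meets-a)

lemma3 : (s t : ℕ) → 1 ≤ s → s ≤ t → (G₁ G₂ : Graph) →
    ¬ HasKstMinor G₁ s t → ¬ HasKstMinor G₂ s t →
    IsClique G₁ (Common G₁ G₂) → IsClique G₂ (Common G₁ G₂) →
    CardLt (Common G₁ G₂) s →
    ¬ HasKstMinor (G₁ ∪G G₂) s t
lemma3 s t _ s≤t G₁ G₂ no-minor₁ no-minor₂ clique₁ clique₂ (L , _ , C⇔L , |L|<s)
       M@(Z , nonempty , ⊆V , disjoint , _ , _) =
  ¬¬-some-set-avoids (Z ∘ inj₁) (disjoint-on inj₁-injective) L |L|<s λ (a , a-avoids) →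
  ¬¬-some-set-avoids (Z ∘ inj₂) (disjoint-on inj₂-injective) L (<-≤-trans |L|<s s≤t) λ (b , b-avoids) →
  let (x , zx) = nonempty (inj₁ a) in
  [ (λ x∈₁ → no-minor₁ (Union.Kst-minor-in-G₁ G₁ G₂ clique₁ M a b
                 (avoid a-avoids) (avoid b-avoids) (x , zx , x∈₁)))
  , (λ x∈₂ → no-minor₂ (Union.Kst-minor-in-G₁ G₂ G₁ (λ p q → clique₂ (swap p) (swap q)) (HasMinor-∪G-comm M) a b
                 (λ z → avoid a-avoids z ∘ swap) (λ z → avoid b-avoids z ∘ swap) (x , zx , x∈₂)))
  ]′ (∈-++⁻ (V G₁) (⊆V (inj₁ a) zx))
  where
  disjoint-on : ∀ {A : Set} {ι : A → Fin s ⊎ Fin t} → (∀ {i j} → ι i ≡ ι j → i ≡ j) →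
    ∀ {i j x} → i ≢ j → Z (ι i) x → Z (ι j) x → ⊥
  disjoint-on {ι = ι} injective i≢j = disjoint (ι _) (ι _) (i≢j ∘ injective)
  avoid : ∀ {Y : ℕ → Set} → (∀ {x} → Y x → x ∉ L) → ∀ {x} → Y x → ¬ Common G₁ G₂ x
  avoid avoids y Cx = avoids y (proj₁ (C⇔L _) Cx)
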